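{- Let $p$ be a prime, and let $\alpha=(\alpha_1,\ldots,\alpha_m)$ and $\beta=(\beta_1,\ldots,\beta_n)$ be elements of $\mathbf{Z}_p$ such that no $\beta_j$ lies in $\mathbf{Z}_{\le 0}$. Write \[ {}_mF_n(\alpha;\beta;z)=\sum_{k\ge 0}A_k z^k,\qquad A_k\in\mathbf{Q}_p . \] Then for every integer $k\ge 0$, \[ \nu_p(A_k)=\sum_{i=1}^m c_p(\alpha_i-1,k)-\sum_{j=1}^n c_p(\beta_j-1,k)+(m-n-1)\,\nu_p(k!). \]
   Context: For an integer $k\ge 0$ the rising factorial is $(x)_0=1$ and $(x)_k=x(x+1)\cdots(x+k-1)$. The generalized hypergeometric series is \[ {}_mF_n(\alpha;\beta;z)=\sum_{k\ge0}\frac{(\alpha_1)_k\cdots(\alpha_m)_k}{(\beta_1)_k\cdots(\beta_n)_k}\frac{z^k}{k!}. \] $\nu_p$ is the $p$-adic valuation, normalized so that $\nu_p(p)=1$, with $\nu_p(0)=\infty$. For $x\in\mathbf{Z}_p$ and an integer $k\ge 0$, $c_p(x,k)\in\mathbf{Z}_{\ge0}\cup\{\infty\}$ is the number of carries that occur when the $p$-adic sum $x+k$ is computed digit by digit in base $p$ by the usual add-and-carry method. -}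

module Defs where

open import Data.Nat as ℕ using (ℕ; zero; suc; _+_; _*_; _^_; _≤_; _<_; _/_; _%_; _!)
open import Data.Integer as ℤ using (ℤ; +_; -_)
open import Data.Integer.DivMod using (_%ℕ_)
open import Data.Fin using (Fin)
open import Data.Product using (Σ; ∃; _×_)
open import Relation.Binary.PropositionalEquality using (_≡_; _≢_)
open import Relation.Nullary using (¬_)

ΣFin : ∀ {A : Set} → (A → A → A) → A → (n : ℕ) → (Fin n → A) → A
ΣFin _⊕_ e zero    f = e
ΣFin _⊕_ e (suc n) f = f Fin.zero ⊕ ΣFin _⊕_ e n (λ i → f (Fin.suc i))
  where import Data.Fin as Fin

-- Residues modulo d (d = 0 never occurs below since p is prime;
-- the zero branches are irrelevant junk).

modℕ : ℕ → ℕ → ℕ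
modℕ a zero    = a
modℕ a (suc d) = a % suc d

modℤ : ℤ → ℕ → ℕ
modℤ a zero    = 0
modℤ a (suc d) = a %ℕ suc d

-- p-adic integers Z_p, as coherent sequences of residues:
-- x i is the residue of x modulo p^i.

Seq : Set
Seq = ℕ → ℕ

IsZp : ℕ → Seq → Set
IsZp p x = ∀ i → (x i < p ^ i) × (modℕ (x (suc i)) (p ^ i) ≡ x i)

_⊞_ : ℕ → Seq → Seq → Seq
(p ⊞ x) y i = modℕ (x i + y i) (p ^ i)

_⊠_ : ℕ → Seq → Seq → Seq
(p ⊠ x) y i = modℕ (x i * y i) (p ^ i)

ι : ℕ → ℤ → Seq
ι p a i = modℤ a (p ^ i)

rising : ℕ → Seq → ℕ → Seq
rising p x zero    = ι p (+ 1)
rising p x (suc k) = _⊠_ p (rising p x k) (_⊞_ p x (ι p (+ k)))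

prodZp : ℕ → (n : ℕ) → (Fin n → Seq) → Seq
prodZp p = ΣFin (_⊠_ p) (ι p (+ 1))

NonPosInt : ℕ → Seq → Set
NonPosInt p x = ∃ λ (N : ℕ) → ∀ i → x i ≡ ι p (- (+ N)) i

data ℕ∞ : Set where
  fin : ℕ → ℕ∞
  ∞   : ℕ∞

data ℤ∞ : Set where
  fin : ℤ → ℤ∞
  ∞   : ℤ∞

_+ℕ∞_ : ℕ∞ → ℕ∞ → ℕ∞
fin a +ℕ∞ fin b = fin (a + b)
_     +ℕ∞ _     = ∞

toℤ∞ : ℕ∞ → ℤ∞
toℤ∞ (fin a) = fin (+ a)
toℤ∞ ∞       = ∞

_⊕ℤ_ : ℤ∞ → ℤ → ℤ∞
fin a ⊕ℤ b = fin (a ℤ.+ b)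
∞     ⊕ℤ b = ∞

-- p-adic valuation of an element of Z_p (as a relation; ν_p(0) = ∞):
-- ν_p(x) ≥ v  iff  x ≡ 0 mod p^v  iff  x v = 0.

HasVal : Seq → ℕ∞ → Set
HasVal x (fin v) = (x v ≡ 0) × (x (suc v) ≢ 0)
HasVal x ∞       = ∀ v → x v ≡ 0

-- Carries in the p-adic sum x + k, computed digit by digit in base p.

-- quotient (d = 0 junk branch, never used since p is prime)
divℕ : ℕ → ℕ → ℕ
divℕ a zero    = 0
divℕ a (suc d) = a / suc d

digitZp : ℕ → Seq → ℕ → ℕ
digitZp p x i = divℕ (x (suc i)) (p ^ i)

digitℕ : ℕ → ℕ → ℕ → ℕ
digitℕ p k i = modℕ (divℕ k (p ^ i)) p

carry : ℕ → Seq → ℕ → ℕ → ℕ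
carry p x k zero    = 0
carry p x k (suc i) = divℕ (digitZp p x i + digitℕ p k i + carry p x k i) p

carriesUpTo : ℕ → Seq → ℕ → ℕ → ℕ
carriesUpTo p x k zero    = 0
carriesUpTo p x k (suc N) = carriesUpTo p x k N + carry p x k (suc N)

CarryCount : ℕ → Seq → ℕ → ℕ∞ → Set
CarryCount p x k (fin c) = ∃ λ N → ∀ M → N ≤ M → carriesUpTo p x k M ≡ c
CarryCount p x k ∞       = ∀ c → ∃ λ N → c ≤ carriesUpTo p x k N

{-# OPTIONS --safe #-}
module Submission where

-- Fix a precision N.  A p-adic integer x is congruent modulo p^N to the natural number
-- 1 + a_N, where a = x - 1, so (x)_k ≡ (1 + a_N)_k (mod p^N).  For a natural number A,
-- ν_p((A+1)_k) = Σ_{j≥1} ⌊(A mod p^j + k)/p^j⌋, since the factor A+1+i is counted once for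
-- every p^j dividing it; for A = a_N the j-th term is ⌊k/p^j⌋ plus the carry into digit j
-- of a + k.  So, below precision N, ν_p((x)_k) = ν_p(k!) + (carries of a + k in the first
-- N digits).  Valuations of products add, and as N → ∞ these truncated valuations and carry
-- counts become ν_p and c_p; comparing A_k (β)_k k! = (α)_k gives the formula.

open import Defs
open import Data.Nat.Base using (ℕ; NonZero)
open import Data.Nat.Primality using (Prime)

module Arithmetic where

  open import Data.Nat.Base using (zero; suc; _+_; _*_; _∸_; _^_; _≤_; _<_; _!; z≤n)
  open import Data.Nat.Properties
  open import Data.Nat.DivMod
  open import Data.Nat.Divisibility using (_∣_; _∣?_; divides; n∣m⇒m%n≡0; m%n≡0⇒n∣m)
  open import Data.Integer.Base using (-[1+_]; _%ℕ_)
  open import Data.Fin.Base as Fin using (Fin)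
  open import Function.Base using (_∘_)
  open import Function.Bundles using (_⇔_; mk⇔; Equivalence)
  open import Algebra.Properties.CommutativeSemigroup +-commutativeSemigroup using (interchange)
  open import Relation.Nullary using (Dec; yes; no; contradiction)
  open import Relation.Binary.PropositionalEquality
  open ≡-Reasoning

  modℕ≡% : ∀ m n .{{_ : NonZero n}} → modℕ m n ≡ m % n
  modℕ≡% m (suc n) = refl

  divℕ≡/ : ∀ m n .{{_ : NonZero n}} → divℕ m n ≡ m / n
  divℕ≡/ m (suc n) = refl

  modℤ≡%ℕ : ∀ i n .{{_ : NonZero n}} → modℤ i n ≡ i %ℕ n
  modℤ≡%ℕ i (suc n) = refl

  -1%ℕn≡n∸1 : ∀ n .{{_ : NonZero n}} → -[1+ 0 ] %ℕ n ≡ n ∸ 1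
  -1%ℕn≡n∸1 (suc zero)    = refl
  -1%ℕn≡n∸1 (suc (suc n)) = refl

  [m%d+n]%d≡[m+n]%d : ∀ m n d .{{_ : NonZero d}} → (m % d + n) % d ≡ (m + n) % d
  [m%d+n]%d≡[m+n]%d m n d = begin
    (m % d + n) % d           ≡⟨ %-distribˡ-+ (m % d) n d ⟩
    (m % d % d + n % d) % d   ≡⟨ cong (λ r → (r + n % d) % d) (m%n%n≡m%n m d) ⟩
    (m % d + n % d) % d       ≡⟨ %-distribˡ-+ m n d ⟨
    (m + n) % d               ∎

  m%d≡n%d⇒d∣m⇔d∣n : ∀ {m n} d .{{_ : NonZero d}} → m % d ≡ n % d → d ∣ m ⇔ d ∣ n
  m%d≡n%d⇒d∣m⇔d∣n {m} {n} d m≡n = mk⇔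
    (λ d∣m → m%n≡0⇒n∣m n d (trans (sym m≡n) (n∣m⇒m%n≡0 m d d∣m)))
    (λ d∣n → m%n≡0⇒n∣m m d (trans m≡n (n∣m⇒m%n≡0 n d d∣n)))

  [m+kn]/n≡m/n+k : ∀ m k n .{{_ : NonZero n}} → (m + k * n) / n ≡ m / n + k
  [m+kn]/n≡m/n+k m k n = trans (+-distrib-/-∣ʳ m (divides k refl)) (cong (m / n +_) (m*n/n≡m k n))

  𝟙 : {A : Set} → Dec A → ℕ
  𝟙 (yes _) = 1
  𝟙 (no _)  = 0

  𝟙-cong : ∀ {A B : Set} → A ⇔ B → (A? : Dec A) (B? : Dec B) → 𝟙 A? ≡ 𝟙 B?
  𝟙-cong A⇔B (yes _) (yes _) = refl
  𝟙-cong A⇔B (yes a) (no ¬b) = contradiction (Equivalence.to A⇔B a) ¬b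
  𝟙-cong A⇔B (no ¬a) (yes b) = contradiction (Equivalence.from A⇔B b) ¬a
  𝟙-cong A⇔B (no _)  (no _)  = refl

  [1+m]/n≡m/n+𝟙[n∣1+m] : ∀ m n .{{_ : NonZero n}} → suc m / n ≡ m / n + 𝟙 (n ∣? suc m)
  [1+m]/n≡m/n+𝟙[n∣1+m] m n with n ∣? suc m
  ... | yes n∣1+m = begin
    suc m / n                     ≡⟨ cong (λ r → suc r / n) (m≡m%n+[m/n]*n m n) ⟩
    suc (m % n + m / n * n) / n   ≡⟨ cong (λ r → suc (r + m / n * n) / n) (%-pred-≡0 (n∣m⇒m%n≡0 (suc m) n n∣1+m)) ⟩
    (suc (n ∸ 1) + m / n * n) / n ≡⟨ cong (λ r → (r + m / n * n) / n) (suc-pred n) ⟩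
    suc (m / n) * n / n           ≡⟨ m*n/n≡m (suc (m / n)) n ⟩
    suc (m / n)                   ≡⟨ +-comm 1 (m / n) ⟩
    m / n + 1                     ∎
  ... | no n∤1+m = begin
    suc m / n                     ≡⟨ cong (λ r → suc r / n) (m≡m%n+[m/n]*n m n) ⟩
    (suc (m % n) + m / n * n) / n ≡⟨ [m+kn]/n≡m/n+k (suc (m % n)) (m / n) n ⟩
    suc (m % n) / n + m / n       ≡⟨ cong (_+ m / n) (m<n⇒m/n≡0 1+m%n<n) ⟩
    m / n                         ≡⟨ +-identityʳ (m / n) ⟨
    m / n + 0                     ∎
    where
    1+m%n<n : suc (m % n) < n
    1+m%n<n = ≤∧≢⇒< (m%n<n m n) λ 1+m%n≡n → n∤1+m (divides (suc (m / n)) (begin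
      suc m                   ≡⟨ cong suc (m≡m%n+[m/n]*n m n) ⟩
      suc (m % n) + m / n * n ≡⟨ cong (_+ m / n * n) 1+m%n≡n ⟩
      suc (m / n) * n         ∎))

  ^-monoʳ-∣ : ∀ m {n o} → n ≤ o → m ^ n ∣ m ^ o
  ^-monoʳ-∣ m {n} {o} n≤o = divides (m ^ (o ∸ n)) (begin
    m ^ o               ≡⟨ cong (m ^_) (m+[n∸m]≡n n≤o) ⟨
    m ^ (n + (o ∸ n))   ≡⟨ ^-distribˡ-+-* m n (o ∸ n) ⟩
    m ^ n * m ^ (o ∸ n) ≡⟨ *-comm (m ^ n) _ ⟩
    m ^ (o ∸ n) * m ^ n ∎)

  _↑_ : ℕ → ℕ → ℕ
  x ↑ zero  = 1
  x ↑ suc k = x ↑ k * (x + k)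

  1↑k≡k! : ∀ k → 1 ↑ k ≡ k !
  1↑k≡k! zero    = refl
  1↑k≡k! (suc k) = trans (cong (_* suc k) (1↑k≡k! k)) (*-comm (k !) (suc k))

  sumTo : (ℕ → ℕ) → ℕ → ℕ
  sumTo f zero    = 0
  sumTo f (suc N) = sumTo f N + f (suc N)

  sumTo-cong : ∀ {f g} N → (∀ {j} → j ≤ N → f j ≡ g j) → sumTo f N ≡ sumTo g N
  sumTo-cong zero    f≡g = refl
  sumTo-cong (suc N) f≡g = cong₂ _+_ (sumTo-cong N (f≡g ∘ m≤n⇒m≤1+n)) (f≡g ≤-refl)

  sumTo-+ : ∀ f g N → sumTo (λ j → f j + g j) N ≡ sumTo f N + sumTo g N
  sumTo-+ f g zero    = refl
  sumTo-+ f g (suc N) = trans (cong (_+ (f (suc N) + g (suc N))) (sumTo-+ f g N))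
                              (interchange (sumTo f N) (sumTo g N) (f (suc N)) (g (suc N)))

  sumTo-zero : ∀ {f} N → (∀ j → f j ≡ 0) → sumTo f N ≡ 0
  sumTo-zero zero    f≡0 = refl
  sumTo-zero (suc N) f≡0 = cong₂ _+_ (sumTo-zero N f≡0) (f≡0 (suc N))

  sumTo-𝟙≤ : ∀ {A : ℕ → Set} (A? : ∀ j → Dec (A j)) N → sumTo (λ j → 𝟙 (A? j)) N ≤ N
  sumTo-𝟙≤ A? zero    = z≤n
  sumTo-𝟙≤ A? (suc N) = ≤-trans (+-mono-≤ (sumTo-𝟙≤ A? N) (𝟙≤1 (A? (suc N)))) (≤-reflexive (+-comm N 1))
    where
    𝟙≤1 : ∀ {B : Set} (B? : Dec B) → 𝟙 B? ≤ 1
    𝟙≤1 (yes _) = ≤-refl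
    𝟙≤1 (no _)  = z≤n

  sumFin : (m : ℕ) → (Fin m → ℕ) → ℕ
  sumFin = ΣFin _+_ 0

  prodFin : (m : ℕ) → (Fin m → ℕ) → ℕ
  prodFin = ΣFin _*_ 1

  sumFin-const+ : ∀ m a (f : Fin m → ℕ) → sumFin m (λ i → a + f i) ≡ m * a + sumFin m f
  sumFin-const+ zero    a f = refl
  sumFin-const+ (suc m) a f = trans (cong (a + f Fin.zero +_) (sumFin-const+ m a (f ∘ Fin.suc)))
                                    (interchange a (f Fin.zero) (m * a) (sumFin m (f ∘ Fin.suc)))

module Residues (p : ℕ) {{_ : NonZero p}} where

  open Arithmetic
  open import Data.Nat.Base using (zero; suc; _+_; _*_; _∸_; _^_; _≤_; _<_; z≤n; s≤s; >-nonZero⁻¹)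
  open import Data.Nat.Properties
  open import Data.Nat.DivMod
  open import Data.Nat.Divisibility using (_∣_; n∣m⇒m%n≡0)
  open import Data.Integer.Base using (+_; -_)
  import Data.Fin.Base as Fin
  open import Data.Sum.Base using (inj₁; inj₂)
  open import Data.Product.Base using (proj₁; proj₂)
  open import Function.Base using (_∘_)
  open import Algebra.Properties.CommutativeSemigroup +-commutativeSemigroup using (interchange)
  open import Relation.Binary.PropositionalEquality
  open ≡-Reasoning

  -- Opaque because _^_ is not injective in the exponent, which keeps instance search from
  -- finding NonZero (p ^ n) for a variable n.
  opaque
    p^_ : ℕ → ℕ
    p^ n = p ^ n

    instance
      p^n≢0 : ∀ {n} → NonZero (p^ n)
      p^n≢0 {n} = m^n≢0 p n

  opaque
    unfolding p^_

    p^-zero : p^ 0 ≡ 1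
    p^-zero = refl

    p^-suc : ∀ n → p^ suc n ≡ p * p^ n
    p^-suc n = refl

    p^-+ : ∀ m n → p^ (m + n) ≡ p^ m * p^ n
    p^-+ = ^-distribˡ-+-* p

    p^-monoʳ-∣ : ∀ {m n} → m ≤ n → p^ m ∣ p^ n
    p^-monoʳ-∣ = ^-monoʳ-∣ p

    modℕ-p^ : ∀ x n → modℕ x (p ^ n) ≡ x % p^ n
    modℕ-p^ x n = modℕ≡% x (p ^ n) {{m^n≢0 p n}}

    divℕ-p^ : ∀ x n → divℕ x (p ^ n) ≡ x / p^ n
    divℕ-p^ x n = divℕ≡/ x (p ^ n) {{m^n≢0 p n}}

    ι-+ : ∀ k n → ι p (+ k) n ≡ k % p^ n
    ι-+ k n = modℤ≡%ℕ (+ k) (p ^ n) {{m^n≢0 p n}}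

    p^≡^ : ∀ n → p^ n ≡ p ^ n
    p^≡^ n = refl

    ι-1 : ∀ n → ι p (- (+ 1)) n ≡ p^ n ∸ 1
    ι-1 n = trans (modℤ≡%ℕ (- (+ 1)) (p ^ n) {{m^n≢0 p n}}) (-1%ℕn≡n∸1 (p ^ n) {{m^n≢0 p n}})

  o%p^n%p^m≡o%p^m : ∀ o {m n} → m ≤ n → o % p^ n % p^ m ≡ o % p^ m
  o%p^n%p^m≡o%p^m o m≤n = m∣n⇒o%n%m≡o%m _ _ o (p^-monoʳ-∣ m≤n)

  digitℕ≡ : ∀ k j → digitℕ p k j ≡ k % p^ suc j / p^ j
  digitℕ≡ k j = begin
    modℕ (divℕ k (p ^ j)) p ≡⟨ trans (modℕ≡% _ p) (cong (_% p) (divℕ-p^ k j)) ⟩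
    k / p^ j % p            ≡⟨ m%[n*o]/o≡m/o%n k p (p^ j) ⟨
    k % (p * p^ j) / p^ j   ≡⟨ /-congˡ (%-congʳ (p^-suc j)) ⟨
    k % p^ suc j / p^ j     ∎
    where instance p*p^j≢0 = m*n≢0 p (p^ j)

  Coherent : Seq → Set
  Coherent x = ∀ {m n} → m ≤ n → x n % p^ m ≡ x m

  IsZp⇒Coherent : ∀ {x} → IsZp p x → Coherent x
  IsZp⇒Coherent {x} x∈Zp {m} {n} m≤n with m≤n⇒m<n∨m≡n m≤n
  ... | inj₂ refl = m<n⇒m%n≡m (subst (x m <_) (sym (p^≡^ m)) (proj₁ (x∈Zp m)))
  ... | inj₁ (s≤s {n = n′} m≤n′) = begin
    x (suc n′) % p^ m          ≡⟨ o%p^n%p^m≡o%p^m (x (suc n′)) m≤n′ ⟨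
    x (suc n′) % p^ n′ % p^ m  ≡⟨ cong (_% p^ m) (trans (sym (modℕ-p^ _ n′)) (proj₂ (x∈Zp n′))) ⟩
    x n′ % p^ m                ≡⟨ IsZp⇒Coherent x∈Zp m≤n′ ⟩
    x m                        ∎

  Coherent-residues : ∀ k → Coherent (λ j → k % p^ j)
  Coherent-residues k = o%p^n%p^m≡o%p^m k

  Coherent-⊞ : ∀ {x y} → Coherent x → Coherent y → Coherent ((p ⊞ x) y)
  Coherent-⊞ {x} {y} cx cy {m} {n} m≤n = begin
    modℕ (x n + y n) (p ^ n) % p^ m   ≡⟨ cong (_% p^ m) (modℕ-p^ _ n) ⟩
    (x n + y n) % p^ n % p^ m         ≡⟨ o%p^n%p^m≡o%p^m _ m≤n ⟩
    (x n + y n) % p^ m                ≡⟨ %-distribˡ-+ (x n) (y n) (p^ m) ⟩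
    (x n % p^ m + y n % p^ m) % p^ m  ≡⟨ cong₂ (λ a b → (a + b) % p^ m) (cx m≤n) (cy m≤n) ⟩
    (x m + y m) % p^ m                ≡⟨ modℕ-p^ _ m ⟨
    modℕ (x m + y m) (p ^ m)          ∎

  Coherent-ι-1 : Coherent (ι p (- (+ 1)))
  Coherent-ι-1 {m} {n} m≤n = begin
    ι p (- (+ 1)) n % p^ m  ≡⟨ cong (_% p^ m) (ι-1 n) ⟩
    (p^ n ∸ 1) % p^ m       ≡⟨ %-pred-≡0 p^m∣p^n ⟩
    p^ m ∸ 1                ≡⟨ ι-1 m ⟨
    ι p (- (+ 1)) m         ∎
    where
    p^m∣p^n : suc (p^ n ∸ 1) % p^ m ≡ 0
    p^m∣p^n = trans (cong (_% p^ m) (suc-pred (p^ n))) (n∣m⇒m%n≡0 _ _ (p^-monoʳ-∣ m≤n))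

  pred-Zp : Seq → Seq
  pred-Zp x = (p ⊞ x) (ι p (- (+ 1)))

  Coherent-pred-Zp : ∀ {x} → Coherent x → Coherent (pred-Zp x)
  Coherent-pred-Zp cx = Coherent-⊞ cx Coherent-ι-1

  Lifts : ℕ → Seq → ℕ → Set
  Lifts N x X = ∀ {v} → v ≤ N → x v ≡ X % p^ v

  Coherent⇒Lifts : ∀ {x} → Coherent x → ∀ N → Lifts N x (x N)
  Coherent⇒Lifts cx N v≤N = sym (cx v≤N)

  Lifts-resp : ∀ {N x X Y} → X % p^ N ≡ Y % p^ N → Lifts N x X → Lifts N x Y
  Lifts-resp {N} {x} {X} {Y} X≡Y x↑X {v} v≤N = begin
    x v              ≡⟨ x↑X v≤N ⟩
    X % p^ v         ≡⟨ o%p^n%p^m≡o%p^m X v≤N ⟨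
    X % p^ N % p^ v  ≡⟨ cong (_% p^ v) X≡Y ⟩
    Y % p^ N % p^ v  ≡⟨ o%p^n%p^m≡o%p^m Y v≤N ⟩
    Y % p^ v         ∎

  Lifts-ι : ∀ N k → Lifts N (ι p (+ k)) k
  Lifts-ι N k {v} _ = ι-+ k v

  Lifts-⊞ : ∀ {N x y X Y} → Lifts N x X → Lifts N y Y → Lifts N ((p ⊞ x) y) (X + Y)
  Lifts-⊞ {x = x} {y} {X} {Y} x↑X y↑Y {v} v≤N = begin
    modℕ (x v + y v) (p ^ v)      ≡⟨ modℕ-p^ _ v ⟩
    (x v + y v) % p^ v            ≡⟨ cong₂ (λ a b → (a + b) % p^ v) (x↑X v≤N) (y↑Y v≤N) ⟩
    (X % p^ v + Y % p^ v) % p^ v  ≡⟨ %-distribˡ-+ X Y (p^ v) ⟨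
    (X + Y) % p^ v                ∎

  Lifts-⊠ : ∀ {N x y X Y} → Lifts N x X → Lifts N y Y → Lifts N ((p ⊠ x) y) (X * Y)
  Lifts-⊠ {x = x} {y} {X} {Y} x↑X y↑Y {v} v≤N = begin
    modℕ (x v * y v) (p ^ v)        ≡⟨ modℕ-p^ _ v ⟩
    (x v * y v) % p^ v              ≡⟨ cong₂ (λ a b → (a * b) % p^ v) (x↑X v≤N) (y↑Y v≤N) ⟩
    (X % p^ v * (Y % p^ v)) % p^ v  ≡⟨ %-distribˡ-* X Y (p^ v) ⟨
    (X * Y) % p^ v                  ∎

  Lifts-rising : ∀ {N x X} → Lifts N x X → ∀ k → Lifts N (rising p x k) (X ↑ k)
  Lifts-rising x↑X zero    = Lifts-ι _ 1
  Lifts-rising x↑X (suc k) = Lifts-⊠ (Lifts-rising x↑X k) (Lifts-⊞ x↑X (Lifts-ι _ k))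

  Lifts-prodZp : ∀ {N} m {f F} → (∀ i → Lifts N (f i) (F i)) → Lifts N (prodZp p m f) (prodFin m F)
  Lifts-prodZp zero    _   = Lifts-ι _ 1
  Lifts-prodZp (suc m) f↑F = Lifts-⊠ (f↑F Fin.zero) (Lifts-prodZp m (f↑F ∘ Fin.suc))

  Lifts-suc-pred-Zp : ∀ {x} → Coherent x → ∀ N → Lifts N x (suc (pred-Zp x N))
  Lifts-suc-pred-Zp {x} cx N = Lifts-resp (sym 1+x⁻≡x) (Coherent⇒Lifts cx N)
    where
    1+x⁻≡x : suc (pred-Zp x N) % p^ N ≡ x N % p^ N
    1+x⁻≡x = begin
      suc (modℕ (x N + ι p (- (+ 1)) N) (p ^ N)) % p^ N
        ≡⟨ cong (λ a → suc a % p^ N) (trans (modℕ-p^ _ N) (cong (λ a → (x N + a) % p^ N) (ι-1 N))) ⟩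
      suc ((x N + (p^ N ∸ 1)) % p^ N) % p^ N   ≡⟨ cong (_% p^ N) (+-comm 1 _) ⟩
      ((x N + (p^ N ∸ 1)) % p^ N + 1) % p^ N   ≡⟨ [m%d+n]%d≡[m+n]%d _ 1 (p^ N) ⟩
      (x N + (p^ N ∸ 1) + 1) % p^ N            ≡⟨ cong (_% p^ N) (+-assoc (x N) _ 1) ⟩
      (x N + (p^ N ∸ 1 + 1)) % p^ N            ≡⟨ cong (λ a → (x N + a) % p^ N) (m∸n+n≡m (>-nonZero⁻¹ (p^ N))) ⟩
      (x N + p^ N) % p^ N                      ≡⟨ [m+n]%n≡m%n (x N) (p^ N) ⟩
      x N % p^ N                               ∎

  digit-split : ∀ {x} → Coherent x → ∀ j → x (suc j) ≡ x j + x (suc j) / p^ j * p^ j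
  digit-split {x} cx j = trans (m≡m%n+[m/n]*n (x (suc j)) (p^ j)) (cong (_+ x (suc j) / p^ j * p^ j) (cx (n≤1+n j)))

  [x+y]/p^-step : ∀ {x y} → Coherent x → Coherent y → ∀ j →
    (x (suc j) + y (suc j)) / p^ j ≡ (x j + y j) / p^ j + (x (suc j) / p^ j + y (suc j) / p^ j)
  [x+y]/p^-step {x} {y} cx cy j = begin
    (x (suc j) + y (suc j)) / q              ≡⟨ cong₂ (λ a b → (a + b) / q) (digit-split cx j) (digit-split cy j) ⟩
    (x j + dx * q + (y j + dy * q)) / q      ≡⟨ cong (_/ q) (interchange (x j) (dx * q) (y j) (dy * q)) ⟩
    (x j + y j + (dx * q + dy * q)) / q      ≡⟨ cong (λ a → (x j + y j + a) / q) (*-distribʳ-+ q dx dy) ⟨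
    (x j + y j + (dx + dy) * q) / q          ≡⟨ [m+kn]/n≡m/n+k (x j + y j) (dx + dy) q ⟩
    (x j + y j) / q + (dx + dy)              ∎
    where
    q  = p^ j
    dx = x (suc j) / q
    dy = y (suc j) / q

  carry≡ : ∀ {a} → Coherent a → ∀ k j → carry p a k j ≡ (a j + k % p^ j) / p^ j
  carry≡ {a} ca k zero = sym (begin
    (a 0 + k % p^ 0) / p^ 0  ≡⟨ /-congʳ p^-zero ⟩
    (a 0 + k % p^ 0) / 1     ≡⟨ n/1≡n _ ⟩
    a 0 + k % p^ 0           ≡⟨ cong₂ _+_ (trans (sym (ca z≤n)) (m%1≡0 (a 0))) (m%1≡0 k) ⟩
    0                        ∎)
    where
    m%1≡0 : ∀ m → m % p^ 0 ≡ 0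
    m%1≡0 m = trans (%-congʳ p^-zero) (n%1≡0 m)
  carry≡ {a} ca k (suc j) = begin
    divℕ (digitZp p a j + digitℕ p k j + carry p a k j) p
      ≡⟨ divℕ≡/ _ p ⟩
    (digitZp p a j + digitℕ p k j + carry p a k j) / p
      ≡⟨ cong₂ (λ d c → (d + c) / p) (cong₂ _+_ (divℕ-p^ _ j) (digitℕ≡ k j)) (carry≡ ca k j) ⟩
    (a (suc j) / q + k % p^ suc j / q + (a j + k % q) / q) / p
      ≡⟨ cong (_/ p) (trans (+-comm (a (suc j) / q + k % p^ suc j / q) _) (sym ([x+y]/p^-step ca (Coherent-residues k) j))) ⟩
    (a (suc j) + k % p^ suc j) / q / p
      ≡⟨ m/n/o≡m/[n*o] _ q p ⟩
    (a (suc j) + k % p^ suc j) / (q * p)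
      ≡⟨ /-congʳ (trans (*-comm q p) (sym (p^-suc j))) ⟩
    (a (suc j) + k % p^ suc j) / p^ suc j ∎
    where
    q = p^ j
    instance q*p≢0 = m*n≢0 q p

  legendre : ℕ → ℕ → ℕ
  legendre N k = sumTo (λ j → k / p^ j) N

  kummer-sum≡legendre+carries : ∀ {a} → Coherent a → ∀ N k →
    sumTo (λ j → (a N % p^ j + k) / p^ j) N ≡ legendre N k + carriesUpTo p a k N
  kummer-sum≡legendre+carries {a} ca N k = begin
    sumTo (λ j → (a N % p^ j + k) / p^ j) N                   ≡⟨ sumTo-cong N split ⟩
    sumTo (λ j → k / p^ j + (a j + k % p^ j) / p^ j) N        ≡⟨ sumTo-+ _ _ N ⟩
    legendre N k + sumTo (λ j → (a j + k % p^ j) / p^ j) N    ≡⟨ cong (λ c → legendre N k + c) (carries≡ N) ⟨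
    legendre N k + carriesUpTo p a k N                         ∎
    where
    split : ∀ {j} → j ≤ N → (a N % p^ j + k) / p^ j ≡ k / p^ j + (a j + k % p^ j) / p^ j
    split {j} j≤N = begin
      (a N % p^ j + k) / p^ j                          ≡⟨ cong (λ r → (r + k) / p^ j) (ca j≤N) ⟩
      (a j + k) / p^ j                                 ≡⟨ cong (λ r → (a j + r) / p^ j) (m≡m%n+[m/n]*n k (p^ j)) ⟩
      (a j + (k % p^ j + k / p^ j * p^ j)) / p^ j      ≡⟨ cong (_/ p^ j) (+-assoc (a j) _ _) ⟨
      (a j + k % p^ j + k / p^ j * p^ j) / p^ j        ≡⟨ [m+kn]/n≡m/n+k _ (k / p^ j) (p^ j) ⟩
      (a j + k % p^ j) / p^ j + k / p^ j               ≡⟨ +-comm _ (k / p^ j) ⟩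
      k / p^ j + (a j + k % p^ j) / p^ j               ∎
    carries≡ : ∀ M → carriesUpTo p a k M ≡ sumTo (λ j → (a j + k % p^ j) / p^ j) M
    carries≡ zero    = refl
    carries≡ (suc M) = cong₂ _+_ (carries≡ M) (carry≡ ca k (suc M))

module Limits where

  open import Data.Nat.Base using (zero; suc; _+_; _≤_; _⊔_; z≤n; s≤s)
  open import Data.Nat.Properties
  open import Data.Fin.Base as Fin using (Fin)
  open import Data.Product.Base using (∃; _×_; _,_)
  open import Data.Sum.Base using (inj₁; inj₂)
  open import Function.Base using (_∘_)
  open import Relation.Nullary using (¬_; contradiction)
  open import Relation.Binary.PropositionalEquality

  Eventually : (ℕ → Set) → Set
  Eventually P = ∃ λ N₀ → ∀ N → N₀ ≤ N → P N

  eventually-× : ∀ {P Q} → Eventually P → Eventually Q → Eventually (λ N → P N × Q N)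
  eventually-× (M , P≥M) (N , Q≥N) =
    M ⊔ N , λ K M⊔N≤K → P≥M K (≤-trans (m≤m⊔n M N) M⊔N≤K) , Q≥N K (≤-trans (m≤n⊔m M N) M⊔N≤K)

  eventually⇒∃ : ∀ {P} → Eventually P → ∃ P
  eventually⇒∃ (N , P≥N) = N , P≥N N ≤-refl

  infix 4 _⟶_

  _⟶_ : (ℕ → ℕ) → ℕ∞ → Set
  f ⟶ fin c = Eventually (λ N → f N ≡ c)
  f ⟶ ∞     = ∀ c → Eventually (λ N → c ≤ f N)

  fin-injective : ∀ {a b} → _≡_ {A = ℕ∞} (fin a) (fin b) → a ≡ b
  fin-injective refl = refl

  ⟶fin⇒¬⟶∞ : ∀ {f a} → f ⟶ fin a → ¬ (f ⟶ ∞)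
  ⟶fin⇒¬⟶∞ {a = a} f⟶a f⟶∞ with eventually⇒∃ (eventually-× f⟶a (f⟶∞ (suc a)))
  ... | _ , fN≡a , a<fN = <-irrefl (sym fN≡a) a<fN

  ⟶-unique : ∀ {f a b} → f ⟶ a → f ⟶ b → a ≡ b
  ⟶-unique {a = fin a} {fin b} f⟶a f⟶b with eventually⇒∃ (eventually-× f⟶a f⟶b)
  ... | _ , fN≡a , fN≡b = cong fin (trans (sym fN≡a) fN≡b)
  ⟶-unique {a = fin a} {∞}     f⟶a f⟶∞ = contradiction f⟶∞ (⟶fin⇒¬⟶∞ f⟶a)
  ⟶-unique {a = ∞}     {fin b} f⟶∞ f⟶b = contradiction f⟶∞ (⟶fin⇒¬⟶∞ f⟶b)
  ⟶-unique {a = ∞}     {∞}     _   _   = refl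

  ⟶-cong : ∀ {f g a} → (∀ N → f N ≡ g N) → f ⟶ a → g ⟶ a
  ⟶-cong {a = fin a} f≡g (N₀ , fN≡a) = N₀ , λ N N₀≤N → trans (sym (f≡g N)) (fN≡a N N₀≤N)
  ⟶-cong {a = ∞}     f≡g f⟶∞ c with f⟶∞ c
  ... | N₀ , c≤fN = N₀ , λ N N₀≤N → ≤-trans (c≤fN N N₀≤N) (≤-reflexive (f≡g N))

  ⟶-map : ∀ {f a} (g : ℕ → ℕ) → f ⟶ fin a → (g ∘ f) ⟶ fin (g a)
  ⟶-map g (N₀ , fN≡a) = N₀ , λ N N₀≤N → cong g (fN≡a N N₀≤N)

  ⟶-+ : ∀ {f g a b} → f ⟶ a → g ⟶ b → (λ N → f N + g N) ⟶ a +ℕ∞ b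
  ⟶-+ {a = fin a} {fin b} f⟶a g⟶b with eventually-× f⟶a g⟶b
  ... | N₀ , both = N₀ , λ N N₀≤N → let fN≡a , gN≡b = both N N₀≤N in cong₂ _+_ fN≡a gN≡b
  ⟶-+ {f = f} {a = fin a} {∞} f⟶a g⟶∞ c with g⟶∞ c
  ... | N₀ , c≤gN = N₀ , λ N N₀≤N → ≤-trans (c≤gN N N₀≤N) (m≤n+m _ (f N))
  ⟶-+ {g = g} {a = ∞} f⟶∞ g⟶b c with f⟶∞ c
  ... | N₀ , c≤fN = N₀ , λ N N₀≤N → ≤-trans (c≤fN N N₀≤N) (m≤m+n _ (g N))

  ⟶-ΣFin : ∀ m {f : Fin m → ℕ → ℕ} {c : Fin m → ℕ∞} → (∀ i → f i ⟶ c i) →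
            (λ N → ΣFin _+_ 0 m (λ i → f i N)) ⟶ ΣFin _+ℕ∞_ (fin 0) m c
  ⟶-ΣFin zero    _    = 0 , λ _ _ → refl
  ⟶-ΣFin (suc m) f⟶c = ⟶-+ (f⟶c Fin.zero) (⟶-ΣFin m (f⟶c ∘ Fin.suc))

  ΣFin-fin : ∀ n (c : Fin n → ℕ) → ΣFin _+ℕ∞_ (fin 0) n (fin ∘ c) ≡ fin (ΣFin _+_ 0 n c)
  ΣFin-fin zero    c = refl
  ΣFin-fin (suc n) c = cong (fin (c Fin.zero) +ℕ∞_) (ΣFin-fin n (c ∘ Fin.suc))

  carriesUpTo-mono : ∀ p x k {M N} → M ≤ N → carriesUpTo p x k M ≤ carriesUpTo p x k N
  carriesUpTo-mono p x k {N = zero}  z≤n = ≤-refl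
  carriesUpTo-mono p x k {N = suc N} M≤1+N with m≤n⇒m<n∨m≡n M≤1+N
  ... | inj₁ (s≤s M≤N) = ≤-trans (carriesUpTo-mono p x k M≤N) (m≤m+n _ _)
  ... | inj₂ refl      = ≤-refl

  CarryCount⇒⟶ : ∀ {p x k c} → CarryCount p x k c → carriesUpTo p x k ⟶ c
  CarryCount⇒⟶ {c = fin c} eventually-c = eventually-c
  -- CarryCount with ∞ only says the counts are unbounded; they are monotone in the precision.
  CarryCount⇒⟶ {p} {x} {k} {c = ∞} unbounded c with unbounded c
  ... | N₀ , c≤cN₀ = N₀ , λ N N₀≤N → ≤-trans c≤cN₀ (carriesUpTo-mono p x k N₀≤N)

module Valuations (p : ℕ) (p-prime : Prime p) where

  open import Data.Nat.Base using (zero; suc; _+_; _*_; _≤_; _<_; _!; z≤n; s≤s; nonTrivial⇒≢1; >-nonZero⁻¹)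
  open import Data.Nat.Properties
  open import Data.Nat.DivMod
  open import Data.Nat.Divisibility
  open import Data.Nat.Primality using (prime⇒nonZero; prime⇒nonTrivial; euclidsLemma)
  open import Data.Integer.Base using (+_)
  open import Data.Fin.Base as Fin using (Fin)
  open import Data.Product.Base using (∃; _×_; _,_)
  open import Data.Sum.Base using (inj₁; inj₂; [_,_]′)
  open import Function.Base using (_∘_)
  open import Function.Bundles using (_⇔_; mk⇔; Equivalence)
  import Function.Properties.Equivalence as ⇔
  open import Relation.Nullary using (¬_; yes; no; contradiction)
  open import Relation.Binary.PropositionalEquality
  open ≡-Reasoning

  instance
    p≢0 : NonZero p
    p≢0 = prime⇒nonZero p-prime

  open Arithmetic
  open Limits
  open Residues p public
  open Equivalence using (to; from)

  -- min (ν_p Y) N ≡ min s N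
  ValuationUpTo : ℕ → ℕ → ℕ → Set
  ValuationUpTo N Y s = ∀ {v} → v ≤ N → p^ v ∣ Y ⇔ v ≤ s

  ValuationUpTo-exact : ∀ {N Y s} → ValuationUpTo N Y s → s < N → p^ s ∣ Y × ¬ p^ suc s ∣ Y
  ValuationUpTo-exact val s<N = from (val (<⇒≤ s<N)) ≤-refl , λ p^1+s∣Y → n≮n _ (to (val s<N) p^1+s∣Y)

  ValuationUpTo-1 : ∀ N → ValuationUpTo N 1 0
  ValuationUpTo-1 N {zero}  _ = mk⇔ (λ _ → z≤n) (λ _ → subst (_∣ 1) (sym p^-zero) ∣-refl)
  ValuationUpTo-1 N {suc v} _ = mk⇔ (λ p^1+v∣1 → contradiction (∣1⇒≡1 (∣-trans p∣p^1+v p^1+v∣1)) p≢1) λ ()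
    where
    p≢1 = nonTrivial⇒≢1 {{prime⇒nonTrivial p-prime}}
    p∣p^1+v : p ∣ p^ suc v
    p∣p^1+v = subst (p ∣_) (sym (p^-suc v)) (m∣m*n (p^ v))

  p^[1+s+t]∤ : ∀ {s t y z} → p^ s ∣ y → ¬ p^ suc s ∣ y → p^ t ∣ z → ¬ p^ suc t ∣ z → ¬ p^ suc (s + t) ∣ y * z
  p^[1+s+t]∤ {s} {t} (divides a refl) p^1+s∤y (divides b refl) p^1+t∤z p^1+s+t∣yz =
    [ p^1+s∤y ∘ raise s , p^1+t∤z ∘ raise t ]′ (euclidsLemma a b p-prime p∣ab)
    where
    raise : ∀ s {a} → p ∣ a → p^ suc s ∣ a * p^ s
    raise s {a} p∣a = subst (_∣ a * p^ s) (sym (p^-suc s)) (*-monoˡ-∣ (p^ s) p∣a)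
    yz≡ab*p^[s+t] : a * p^ s * (b * p^ t) ≡ a * b * p^ (s + t)
    yz≡ab*p^[s+t] = trans ([m*n]*[o*p]≡[m*o]*[n*p] a (p^ s) b (p^ t)) (cong (a * b *_) (sym (p^-+ s t)))
    p∣ab : p ∣ a * b
    p∣ab = *-cancelʳ-∣ (p^ (s + t)) (subst₂ _∣_ (p^-suc (s + t)) yz≡ab*p^[s+t] p^1+s+t∣yz)

  ValuationUpTo-* : ∀ {N y z s t} → ValuationUpTo N y s → ValuationUpTo N z t → ValuationUpTo N (y * z) (s + t)
  ValuationUpTo-* {N} {y} {z} {s} {t} val-y val-z {v} v≤N with N ≤? s | N ≤? t
  ... | yes N≤s | _ = mk⇔ (λ _ → ≤-trans v≤N (≤-trans N≤s (m≤m+n s t)))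
                          (λ _ → ∣-trans (p^-monoʳ-∣ v≤N) (∣-trans (from (val-y ≤-refl) N≤s) (m∣m*n z)))
  ... | no _ | yes N≤t = mk⇔ (λ _ → ≤-trans v≤N (≤-trans N≤t (m≤n+m t s)))
                             (λ _ → ∣-trans (p^-monoʳ-∣ v≤N) (∣-trans (from (val-z ≤-refl) N≤t) (n∣m*n y)))
  ... | no N≰s | no N≰t with ValuationUpTo-exact val-y (≰⇒> N≰s) | ValuationUpTo-exact val-z (≰⇒> N≰t)
  ...   | p^s∣y , p^1+s∤y | p^t∣z , p^1+t∤z = mk⇔
    (λ p^v∣yz → ≮⇒≥ λ s+t<v → p^[1+s+t]∤ p^s∣y p^1+s∤y p^t∣z p^1+t∤z (∣-trans (p^-monoʳ-∣ s+t<v) p^v∣yz))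
    (λ v≤s+t → ∣-trans (p^-monoʳ-∣ v≤s+t) (subst (_∣ y * z) (sym (p^-+ s t)) (*-pres-∣ p^s∣y p^t∣z)))

  multiplicity : ℕ → ℕ → ℕ
  multiplicity N Y = sumTo (λ j → 𝟙 (p^ j ∣? Y)) N

  ValuationUpTo-multiplicity : ∀ N Y → ValuationUpTo N Y (multiplicity N Y)
  ValuationUpTo-multiplicity zero    Y z≤n = mk⇔ (λ _ → z≤n) (λ _ → subst (_∣ Y) (sym p^-zero) (1∣ Y))
  ValuationUpTo-multiplicity (suc N) Y {v} v≤1+N with p^ suc N ∣? Y
  ... | yes p^1+N∣Y = mk⇔
    (λ _ → ≤-trans v≤1+N (≤-reflexive (trans (+-comm 1 N) (cong (_+ 1) (sym μ≡N)))))
    (λ _ → ∣-trans (p^-monoʳ-∣ v≤1+N) p^1+N∣Y)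
    where
    μ≡N : multiplicity N Y ≡ N
    μ≡N = ≤-antisym (sumTo-𝟙≤ (λ j → p^ j ∣? Y) N)
      (to (ValuationUpTo-multiplicity N Y ≤-refl) (∣-trans (p^-monoʳ-∣ (n≤1+n N)) p^1+N∣Y))
  ... | no p^1+N∤Y with m≤n⇒m<n∨m≡n v≤1+N
  ...   | inj₁ (s≤s v≤N) = subst (λ s → p^ v ∣ Y ⇔ v ≤ s) (sym (+-identityʳ _))
                                 (ValuationUpTo-multiplicity N Y v≤N)
  ...   | inj₂ refl      = mk⇔ (λ p^1+N∣Y → contradiction p^1+N∣Y p^1+N∤Y)
    (λ 1+N≤μ → contradiction (≤-trans 1+N≤μ (≤-trans (≤-reflexive (+-identityʳ _)) (sumTo-𝟙≤ (λ j → p^ j ∣? Y) N))) (n≮n N))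

  ValuationUpTo-↑ : ∀ N A k → ValuationUpTo N (suc A ↑ k) (sumTo (λ j → (A % p^ j + k) / p^ j) N)
  ValuationUpTo-↑ N A zero = subst (ValuationUpTo N 1) (sym (sumTo-zero N A%p^j/p^j≡0)) (ValuationUpTo-1 N)
    where
    A%p^j/p^j≡0 : ∀ j → (A % p^ j + 0) / p^ j ≡ 0
    A%p^j/p^j≡0 j = trans (cong (_/ p^ j) (+-identityʳ _)) (m<n⇒m/n≡0 (m%n<n A (p^ j)))
  -- The new factor A+1+k is divisible by p^j exactly when ⌊(A mod p^j + k)/p^j⌋ goes up.
  ValuationUpTo-↑ N A (suc k) = subst (ValuationUpTo N (suc A ↑ suc k)) (sym step)
    (ValuationUpTo-* (ValuationUpTo-↑ N A k) (ValuationUpTo-multiplicity N (suc A + k)))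
    where
    term : ∀ j → (A % p^ j + suc k) / p^ j ≡ (A % p^ j + k) / p^ j + 𝟙 (p^ j ∣? suc A + k)
    term j = begin
      (A % q + suc k) / q                         ≡⟨ cong (_/ q) (+-suc (A % q) k) ⟩
      suc (A % q + k) / q                         ≡⟨ [1+m]/n≡m/n+𝟙[n∣1+m] (A % q + k) q ⟩
      (A % q + k) / q + 𝟙 (q ∣? suc (A % q + k))  ≡⟨ cong (λ b → (A % q + k) / q + b) (𝟙-cong (m%d≡n%d⇒d∣m⇔d∣n q same) _ _) ⟩
      (A % q + k) / q + 𝟙 (q ∣? suc A + k)        ∎
      where
      q = p^ j
      same : suc (A % q + k) % q ≡ (suc A + k) % q
      same = begin
        suc (A % q + k) % q  ≡⟨ cong (_% q) (+-suc (A % q) k) ⟨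
        (A % q + suc k) % q  ≡⟨ [m%d+n]%d≡[m+n]%d A (suc k) q ⟩
        (A + suc k) % q      ≡⟨ cong (_% q) (+-suc A k) ⟩
        (suc A + k) % q      ∎
    step : sumTo (λ j → (A % p^ j + suc k) / p^ j) N
         ≡ sumTo (λ j → (A % p^ j + k) / p^ j) N + multiplicity N (suc A + k)
    step = trans (sumTo-cong N (λ {j} _ → term j)) (sumTo-+ _ _ N)

  ZpValuationUpTo : ℕ → Seq → ℕ → Set
  ZpValuationUpTo N y s = ∃ λ Y → Lifts N y Y × ValuationUpTo N Y s

  ZpValuationUpTo-⊠ : ∀ {N x y s t} → ZpValuationUpTo N x s → ZpValuationUpTo N y t →
                      ZpValuationUpTo N ((p ⊠ x) y) (s + t)
  ZpValuationUpTo-⊠ (X , x↑X , val-X) (Y , y↑Y , val-Y) = X * Y , Lifts-⊠ x↑X y↑Y , ValuationUpTo-* val-X val-Y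

  ZpValuationUpTo-prodZp : ∀ {N} m {f : Fin m → Seq} {s : Fin m → ℕ} →
    (∀ i → ZpValuationUpTo N (f i) (s i)) → ZpValuationUpTo N (prodZp p m f) (sumFin m s)
  ZpValuationUpTo-prodZp {N} zero _ = 1 , Lifts-ι N 1 , ValuationUpTo-1 N
  ZpValuationUpTo-prodZp (suc m) val = ZpValuationUpTo-⊠ (val Fin.zero) (ZpValuationUpTo-prodZp m (val ∘ Fin.suc))

  ZpValuationUpTo-rising : ∀ {x} → Coherent x → ∀ N k →
    ZpValuationUpTo N (rising p x k) (legendre N k + carriesUpTo p (pred-Zp x) k N)
  ZpValuationUpTo-rising {x} cx N k =
    suc (pred-Zp x N) ↑ k ,
    Lifts-rising (Lifts-suc-pred-Zp cx N) k ,
    subst (ValuationUpTo N _) (kummer-sum≡legendre+carries (Coherent-pred-Zp cx) N k) (ValuationUpTo-↑ N (pred-Zp x N) k)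

  ZpValuationUpTo-! : ∀ N k → ZpValuationUpTo N (ι p (+ (k !))) (legendre N k)
  ZpValuationUpTo-! N k =
    k ! , Lifts-ι N (k !) , subst₂ (ValuationUpTo N) (1↑k≡k! k) (sumTo-cong N [0%p^j+k]/p^j≡k/p^j) (ValuationUpTo-↑ N 0 k)
    where
    [0%p^j+k]/p^j≡k/p^j : ∀ {j} → j ≤ N → (0 % p^ j + k) / p^ j ≡ k / p^ j
    [0%p^j+k]/p^j≡k/p^j {j} _ = cong (λ r → (r + k) / p^ j) (m<n⇒m%n≡m (>-nonZero⁻¹ (p^ j)))

  ZpValuationUpTo⇒zeros : ∀ {N y s} → ZpValuationUpTo N y s → ∀ {v} → v ≤ N → y v ≡ 0 ⇔ v ≤ s
  ZpValuationUpTo⇒zeros {s = s} (Y , y↑Y , val-Y) {v} v≤N =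
    subst (λ r → r ≡ 0 ⇔ v ≤ s) (sym (y↑Y v≤N)) (⇔.trans (m%n≡0⇔n∣m Y (p^ v)) (val-Y v≤N))

  HasVal⇒⟶ : ∀ {y s v} → (∀ N → ZpValuationUpTo N y (s N)) → HasVal y v → s ⟶ v
  HasVal⇒⟶ {v = fin w} val (yw≡0 , y[1+w]≢0) = suc w , λ N 1+w≤N →
    ≤-antisym (≮⇒≥ λ w<sN → y[1+w]≢0 (from (ZpValuationUpTo⇒zeros (val N) 1+w≤N) w<sN))
              (to (ZpValuationUpTo⇒zeros (val N) (≤-trans (n≤1+n w) 1+w≤N)) yw≡0)
  HasVal⇒⟶ {v = ∞} val y≡0 c = c , λ N c≤N → ≤-trans c≤N (to (ZpValuationUpTo⇒zeros (val N) ≤-refl) (y≡0 N))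

open import Data.Nat as ℕ using (ℕ; _!)
open import Data.Nat.Primality using (Prime)
open import Data.Integer as ℤ using (ℤ; +_; -_; _-_; _*_)
open import Data.Fin using (Fin)
open import Relation.Binary.PropositionalEquality using (_≡_)
open import Relation.Nullary using (¬_)
open import Relation.Binary.PropositionalEquality using (refl; trans; sym; cong; cong₂; subst; module ≡-Reasoning)
open import Data.Integer.Properties using (pos-+; pos-*)
open import Data.Integer.Solver using (module +-*-Solver)
open import Function.Base using (_∘_)
open ≡-Reasoning

valuation-arithmetic : ∀ m n vk B (C : ℕ∞) →
  toℤ∞ (fin (m ℕ.* vk) +ℕ∞ C) ⊕ℤ (- (+ (n ℕ.* vk ℕ.+ B ℕ.+ vk)))
  ≡ toℤ∞ C ⊕ℤ ((- (+ B)) ℤ.+ (((+ m) - (+ n) - (+ 1)) * (+ vk)))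
valuation-arithmetic m n vk B ∞       = refl
valuation-arithmetic m n vk B (fin C) = cong fin (begin
  + (m ℕ.* vk ℕ.+ C) - + (n ℕ.* vk ℕ.+ B ℕ.+ vk)
    ≡⟨ cong₂ _-_ (trans (pos-+ (m ℕ.* vk) C) (cong (ℤ._+ + C) (pos-* m vk)))
                 (trans (pos-+ (n ℕ.* vk ℕ.+ B) vk) (cong (ℤ._+ + vk) (trans (pos-+ (n ℕ.* vk) B) (cong (ℤ._+ + B) (pos-* n vk))))) ⟩
  (+ m * + vk ℤ.+ + C) - (+ n * + vk ℤ.+ + B ℤ.+ + vk)
    ≡⟨ solve 5 (λ m n vk B C → (m :* vk :+ C) :- (n :* vk :+ B :+ vk) := C :+ (:- B :+ (m :- n :- con (+ 1)) :* vk))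
             refl (+ m) (+ n) (+ vk) (+ B) (+ C) ⟩
  + C ℤ.+ ((- (+ B)) ℤ.+ (((+ m) - (+ n) - (+ 1)) * (+ vk))) ∎)
  where open +-*-Solver

corollary2p7 : (p : ℕ) → Prime p → (m n : ℕ)
    → (α : Fin m → Seq) → (β : Fin n → Seq)
    → (∀ i → IsZp p (α i)) → (∀ j → IsZp p (β j))
    → (∀ j → ¬ NonPosInt p (β j))
    → (k : ℕ)
    → (vP : ℕ∞) → HasVal (prodZp p m (λ i → rising p (α i) k)) vP
    → (vQ : ℕ) → HasVal (_⊠_ p (prodZp p n (λ j → rising p (β j) k)) (ι p (+ (k !)))) (fin vQ)
    → (cα : Fin m → ℕ∞) → (∀ i → CarryCount p (_⊞_ p (α i) (ι p (- (+ 1)))) k (cα i))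
    → (cβ : Fin n → ℕ) → (∀ j → CarryCount p (_⊞_ p (β j) (ι p (- (+ 1)))) k (fin (cβ j)))
    → (vk : ℕ) → HasVal (ι p (+ (k !))) (fin vk)
    → toℤ∞ vP ⊕ℤ (- (+ vQ))
    ≡ toℤ∞ (ΣFin _+ℕ∞_ (fin 0) m cα)
    ⊕ℤ ((- (+ ΣFin ℕ._+_ 0 n cβ)) ℤ.+ (((+ m) - (+ n) - (+ 1)) * (+ vk)))
corollary2p7 p p-prime m n α β α∈Zp β∈Zp _ k vP val-P vQ val-Q cα carries-α cβ carries-β vk val-k! =
  trans (cong₂ (λ a b → toℤ∞ a ⊕ℤ (- (+ b))) vP≡ vQ≡)
        (valuation-arithmetic m n vk (sumFin n cβ) (ΣFin _+ℕ∞_ (fin 0) m cα))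
  where
  open Arithmetic
  open Limits
  open Valuations p p-prime

  L : ℕ → ℕ
  L N = legendre N k

  carries : Seq → ℕ → ℕ
  carries x = carriesUpTo p (pred-Zp x) k

  L⟶vk : L ⟶ fin vk
  L⟶vk = HasVal⇒⟶ (λ N → ZpValuationUpTo-! N k) val-k!

  prod-rising : ∀ {l} (x : Fin l → Seq) → (∀ i → IsZp p (x i)) → ∀ N →
    ZpValuationUpTo N (prodZp p l (λ i → rising p (x i) k)) (sumFin l (λ i → L N ℕ.+ carries (x i) N))
  prod-rising x x∈Zp N = ZpValuationUpTo-prodZp _ (λ i → ZpValuationUpTo-rising (IsZp⇒Coherent (x∈Zp i)) N k)

  vP≡ : vP ≡ fin (m ℕ.* vk) +ℕ∞ ΣFin _+ℕ∞_ (fin 0) m cα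
  vP≡ = ⟶-unique
    (HasVal⇒⟶ (prod-rising α α∈Zp) val-P)
    (⟶-cong (λ N → sym (sumFin-const+ m (L N) _))
            (⟶-+ (⟶-map (m ℕ.*_) L⟶vk) (⟶-ΣFin m (CarryCount⇒⟶ ∘ carries-α))))

  vQ≡ : vQ ≡ n ℕ.* vk ℕ.+ sumFin n cβ ℕ.+ vk
  vQ≡ = fin-injective (⟶-unique
    (HasVal⇒⟶ (λ N → ZpValuationUpTo-⊠ (prod-rising β β∈Zp N) (ZpValuationUpTo-! N k)) val-Q)
    (⟶-cong (λ N → cong (ℕ._+ L N) (sym (sumFin-const+ n (L N) _)))
            (⟶-+ (⟶-+ (⟶-map (n ℕ.*_) L⟶vk) β-carries⟶) L⟶vk)))
    where
    β-carries⟶ : (λ N → sumFin n (λ j → carries (β j) N)) ⟶ fin (sumFin n cβ)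
    β-carries⟶ = subst (_ ⟶_) (ΣFin-fin n cβ) (⟶-ΣFin n (CarryCount⇒⟶ ∘ carries-β))
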